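{- Let $\mathcal{C}$ be an $[n,k]_{q^m/q}$ rank-metric code. For every nonzero codeword $v\in\mathcal{C}^\perp$, the support $\sigma(v)\le\mathbb{F}_q^n$ is a dependent space of $M_{\mathcal{C}}$.
   Context: $q$ is a prime power, $m,n,k$ positive integers. An $[n,k]_{q^m/q}$ rank-metric code is a $k$-dimensional $\mathbb{F}_{q^m}$-linear subspace $\mathcal{C}$ of $\mathbb{F}_{q^m}^n$. $\mathcal{C}^\perp$ is its dual with respect to the standard dot product $x\cdot y=\sum_jx_jy_j$. For $v\in\mathbb{F}_{q^m}^n$ and an $\mathbb{F}_q$-basis $\gamma_1,\dots,\gamma_m$ of $\mathbb{F}_{q^m}$, write $v_i=\sum_j\Gamma(v)_{ij}\gamma_j$ with $\Gamma(v)\in\mathbb{F}_q^{n\times m}$; the support $\sigma(v)\le\mathbb{F}_q^n$ is the column space of $\Gamma(v)$ (independent of the basis). For $U\le\mathbb{F}_q^n$ let $U^\perp$ be its orthogonal complement in $\mathbb{F}_q^n$ under the standard dot product and $\mathcal{C}(U)=\{v\in\mathcal{C}:\sigma(v)\le U^\perp\}$. The $q$-matroid $M_{\mathcal{C}}=(\mathbb{F}_q^n,r)$ has rank function $r(U)=k-\dim_{\mathbb{F}_{q^m}}\mathcal{C}(U)$ (equivalently $r(U)=\mathrm{rk}(GA_U^\top)$ for a generator matrix $G$ of $\mathcal{C}$ and a matrix $A_U$ whose rows form a basis of $U$). A subspace $U$ is dependent if $r(U)<\dim U$. -}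

module Defs where

open import Level using (0ℓ)
open import Data.Nat using (ℕ; zero; suc; _<_)
open import Data.Fin using (Fin; zero; suc)
open import Data.Product using (Σ; ∃; _×_; _,_)
open import Relation.Binary.PropositionalEquality using (_≡_)
open import Relation.Nullary using (¬_)
open import Function.Bundles using (_↔_)

record Field : Set₁ where
  infixl 6 _+_
  infixl 7 _*_
  field
    Carrier : Set
    _+_ _*_ : Carrier → Carrier → Carrier
    -_      : Carrier → Carrier
    0# 1#   : Carrier
    +-assoc : ∀ x y z → (x + y) + z ≡ x + (y + z)
    +-comm  : ∀ x y → x + y ≡ y + x
    +-identityˡ : ∀ x → 0# + x ≡ x
    -‿inverseˡ  : ∀ x → (- x) + x ≡ 0#
    *-assoc : ∀ x y z → (x * y) * z ≡ x * (y * z)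
    *-comm  : ∀ x y → x * y ≡ y * x
    *-identityˡ : ∀ x → 1# * x ≡ x
    distribˡ : ∀ x y z → x * (y + z) ≡ (x * y) + (x * z)
    0≢1     : ¬ (0# ≡ 1#)
    inverse : ∀ x → ¬ (x ≡ 0#) → Σ Carrier (λ y → y * x ≡ 1#)

record FieldHom (K L : Field) : Set where
  private
    module K = Field K
    module L = Field L
  field
    ⟦_⟧    : K.Carrier → L.Carrier
    hom-+  : ∀ x y → ⟦ x K.+ y ⟧ ≡ ⟦ x ⟧ L.+ ⟦ y ⟧
    hom-*  : ∀ x y → ⟦ x K.* y ⟧ ≡ ⟦ x ⟧ L.* ⟦ y ⟧
    hom-1  : ⟦ K.1# ⟧ ≡ L.1#

module _ (F : Field) where
  open Field F

  ∑ : ∀ n → (Fin n → Carrier) → Carrier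
  ∑ zero    f = 0#
  ∑ (suc n) f = f zero + ∑ n (λ i → f (suc i))

  Vec : ℕ → Set
  Vec n = Fin n → Carrier

  zeroVec : ∀ n → Vec n
  zeroVec n _ = 0#

  dot : ∀ {n} → Vec n → Vec n → Carrier
  dot {n} x y = ∑ n (λ j → x j * y j)

  lincomb : ∀ {r n} → (Fin r → Carrier) → (Fin r → Vec n) → Vec n
  lincomb {r} c w i = ∑ r (λ j → c j * w j i)

  LinIndep : ∀ {r n} → (Fin r → Vec n) → Set
  LinIndep {r} w = ∀ (c : Fin r → Carrier) → (∀ i → lincomb c w i ≡ 0#) → ∀ j → c j ≡ 0#

  InSpan : ∀ {r n} → (Fin r → Vec n) → Vec n → Set
  InSpan {r} w u = Σ (Fin r → Carrier) (λ c → ∀ i → lincomb c w i ≡ u i)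

  IsBasisOfSpan : ∀ {d r n} → (Fin d → Vec n) → (Fin r → Vec n) → Set
  IsBasisOfSpan a w = LinIndep a × (∀ b → InSpan w (a b)) × (∀ j → InSpan a (w j))

  col : ∀ {k d} → (Fin k → Fin d → Carrier) → Fin d → Vec k
  col M j i = M i j

  HasRank : ∀ {k d} → (Fin k → Fin d → Carrier) → ℕ → Set
  HasRank {k} {d} M r =
    Σ (Fin r → Fin d) (λ s → LinIndep (λ j → col M (s j)))
    × (∀ (s : Fin (suc r) → Fin d) → ¬ LinIndep (λ j → col M (s j)))

HasCard : Field → ℕ → Set
HasCard K q = Fin q ↔ Field.Carrier K

-- Setting: K = F_q, L = F_{q^m} an extension of K via ι, with F_q-basis γ of L.
module RankMetric (K L : Field) (ι : FieldHom K L) where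
  open FieldHom ι using (⟦_⟧)
  private
    module K = Field K
    module L = Field L

  IsBasisOver : ∀ m → (Fin m → L.Carrier) → Set
  IsBasisOver m γ =
    (∀ (c : Fin m → K.Carrier) → ∑ L m (λ j → ⟦ c j ⟧ L.* γ j) ≡ L.0# → ∀ j → c j ≡ K.0#)
    × (∀ x → Σ (Fin m → K.Carrier) (λ c → ∑ L m (λ j → ⟦ c j ⟧ L.* γ j) ≡ x))

  IsCoordMatrix : ∀ {n m} → (Fin m → L.Carrier) → Vec L n → (Fin n → Fin m → K.Carrier) → Set
  IsCoordMatrix {n} {m} γ v Γ = ∀ i → v i ≡ ∑ L m (λ j → ⟦ Γ i j ⟧ L.* γ j)

  -- the code C with generator matrix G (k×n over L, rows L-linearly independent)
  InCode : ∀ {k n} → (Fin k → Vec L n) → Vec L n → Set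
  InCode G c = InSpan L G c

  InDual : ∀ {k n} → (Fin k → Vec L n) → Vec L n → Set
  InDual G v = ∀ c → InCode G c → dot L c v ≡ L.0#

  GAt : ∀ {k n d} → (Fin k → Vec L n) → (Fin d → Vec K n) → Fin k → Fin d → L.Carrier
  GAt {n = n} G A a b = ∑ L n (λ i → G a i L.* ⟦ A b i ⟧)

  -- U (given by a basis A of d vectors, so dim U = d) is dependent in M_C: r(U) < dim U,
  -- with r(U) = rk(G A^⊤)
  Dependent : ∀ {k n d} → (Fin k → Vec L n) → (Fin d → Vec K n) → Set
  Dependent {d = d} G A = ∀ r → HasRank L (GAt G A) r → r < d

-- Write v = Σ_b λ_b ι(A_b): the coordinate columns of v are F_q-combinations of the basis A
-- of σ(v), so λ_b = Σ_j c_jb γ_j works. Since v is orthogonal to every row of G, the columns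
-- of G A^⊤ satisfy the relation Σ_b λ_b (G A^⊤)_b = G v = 0, and λ ≠ 0 because v ≠ 0. Hence no
-- d columns of G A^⊤ are independent, i.e. r(σ(v)) < d = dim σ(v).
{-# OPTIONS --safe #-}
module Submission where

open import Defs
open import Data.Nat using (ℕ; _<_)
open import Data.Fin using (Fin)
open import Relation.Binary.PropositionalEquality using (_≡_)
open import Relation.Nullary using (¬_)

open import Level using (0ℓ)
open import Data.Nat using (zero; suc)
open import Data.Nat.Properties using (m≤n⇒m<n∨m≡n; n<1+n)
open import Data.Fin using (zero; suc; punchOut; _≟_)
open import Data.Fin.Properties using (injective⇒≤; <⇒notInjective; punchOut-injective; any?)
open import Data.Fin.Permutation using (Permutation′; permutation)
open import Data.Product using (_,_; proj₁; proj₂)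
open import Data.Sum using (inj₁; inj₂)
open import Data.Empty using (⊥-elim)
open import Relation.Nullary using (yes; no; contradiction)
open import Relation.Binary.PropositionalEquality
  using (refl; sym; trans; cong; cong₂; isEquivalence; module ≡-Reasoning)
open import Function.Definitions using (Injective; StrictlySurjective)
open import Algebra.Bundles using (CommutativeRing)
open import Algebra.Consequences.Propositional
  using (comm∧idˡ⇒id; comm∧invˡ⇒inv; comm∧distrˡ⇒distrʳ)
import Algebra.Properties.Ring as RingProperties
import Algebra.Properties.CommutativeSemigroup as CommutativeSemigroupProperties
import Algebra.Properties.CommutativeMonoid.Sum as Sum

injective⇒surjective : ∀ {n} {s : Fin n → Fin n} → Injective _≡_ _≡_ s → StrictlySurjective _≡_ s
injective⇒surjective {zero}  _ ()
injective⇒surjective {suc n} {s} s-inj b with any? (λ j → s j ≟ b)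
... | yes hit  = hit
... | no ¬hit  = ⊥-elim (<⇒notInjective (n<1+n n) punchOut-inj)
  where
  s≢b : ∀ j → ¬ (b ≡ s j)
  s≢b j b≡sj = ¬hit (j , sym b≡sj)

  punchOut-inj : Injective _≡_ _≡_ (λ j → punchOut (s≢b j))
  punchOut-inj e = s-inj (punchOut-injective (s≢b _) (s≢b _) e)

commutativeRing : Field → CommutativeRing 0ℓ 0ℓ
commutativeRing F = record
  { Carrier = Carrier ; _≈_ = _≡_ ; _+_ = _+_ ; _*_ = _*_ ; -_ = -_ ; 0# = 0# ; 1# = 1#
  ; isCommutativeRing = record
    { isRing = record
      { +-isAbelianGroup = record
        { isGroup = record
          { isMonoid = record
            { isSemigroup = record
              { isMagma = record { isEquivalence = isEquivalence ; ∙-cong = cong₂ _+_ }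
              ; assoc = +-assoc }
            ; identity = comm∧idˡ⇒id +-comm +-identityˡ }
          ; inverse = comm∧invˡ⇒inv +-comm -‿inverseˡ
          ; ⁻¹-cong = cong -_ }
        ; comm = +-comm }
      ; *-cong = cong₂ _*_
      ; *-assoc = *-assoc
      ; *-identity = comm∧idˡ⇒id *-comm *-identityˡ
      ; distrib = distribˡ , comm∧distrˡ⇒distrʳ *-comm distribˡ }
    ; *-comm = *-comm } }
  where open Field F

module LinearAlgebra (F : Field) where
  open CommutativeRing (commutativeRing F) hiding (refl; sym; trans; zero)
  open RingProperties ring using (-0#≈0#; -‿+-comm; -‿distribˡ-*)
  open CommutativeSemigroupProperties *-commutativeSemigroup using (x∙yz≈y∙xz; xy∙z≈xz∙y)
  open CommutativeSemigroupProperties +-commutativeSemigroup using () renaming (interchange to +-interchange)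
  open ≡-Reasoning

  ∑-cong : ∀ n {f g : Fin n → Carrier} → (∀ i → f i ≡ g i) → ∑ F n f ≡ ∑ F n g
  ∑-cong zero    f≗g = refl
  ∑-cong (suc n) f≗g = cong₂ _+_ (f≗g zero) (∑-cong n (λ i → f≗g (suc i)))

  ∑-zero : ∀ n → ∑ F n (λ _ → 0#) ≡ 0#
  ∑-zero zero    = refl
  ∑-zero (suc n) = trans (cong (0# +_) (∑-zero n)) (+-identityˡ 0#)

  ∑-distrib-+ : ∀ n (f g : Fin n → Carrier) →
                ∑ F n (λ i → f i + g i) ≡ ∑ F n f + ∑ F n g
  ∑-distrib-+ zero    f g = sym (+-identityˡ 0#)
  ∑-distrib-+ (suc n) f g = trans (cong (f zero + g zero +_) (∑-distrib-+ n _ _))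
                                  (+-interchange (f zero) (g zero) _ _)

  ∑-neg : ∀ n (f : Fin n → Carrier) → ∑ F n (λ i → - f i) ≡ - ∑ F n f
  ∑-neg zero    f = sym -0#≈0#
  ∑-neg (suc n) f = trans (cong (- f zero +_) (∑-neg n _)) (-‿+-comm (f zero) _)

  *-distribˡ-∑ : ∀ n x (f : Fin n → Carrier) → x * ∑ F n f ≡ ∑ F n (λ i → x * f i)
  *-distribˡ-∑ zero    x f = zeroʳ x
  *-distribˡ-∑ (suc n) x f = trans (distribˡ x _ _) (cong (x * f zero +_) (*-distribˡ-∑ n x _))

  *-distribʳ-∑ : ∀ n x (f : Fin n → Carrier) → ∑ F n f * x ≡ ∑ F n (λ i → f i * x)
  *-distribʳ-∑ zero    x f = zeroˡ x
  *-distribʳ-∑ (suc n) x f = trans (distribʳ x _ _) (cong (f zero * x +_) (*-distribʳ-∑ n x _))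

  ∑-comm : ∀ m n (f : Fin m → Fin n → Carrier) →
           ∑ F m (λ i → ∑ F n (f i)) ≡ ∑ F n (λ j → ∑ F m (λ i → f i j))
  ∑-comm zero    n f = sym (∑-zero n)
  ∑-comm (suc m) n f = trans (cong (∑ F n (f zero) +_) (∑-comm m n (λ i → f (suc i))))
                             (sym (∑-distrib-+ n (f zero) _))

  ∑-reindex : ∀ n {s : Fin n → Fin n} → Injective _≡_ _≡_ s →
              (f : Fin n → Carrier) → ∑ F n (λ j → f (s j)) ≡ ∑ F n f
  ∑-reindex n {s} s-inj f = begin
    ∑ F n (λ j → f (s j))  ≡⟨ sym (∑≡sum n _) ⟩
    sum (λ j → f (s j))    ≡⟨ sym (sum-permute f π) ⟩
    sum f                  ≡⟨ ∑≡sum n f ⟩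
    ∑ F n f                ∎
    where
    open Sum +-commutativeMonoid using (sum; sum-permute)

    ∑≡sum : ∀ n (g : Fin n → Carrier) → sum g ≡ ∑ F n g
    ∑≡sum zero    g = refl
    ∑≡sum (suc n) g = cong (g zero +_) (∑≡sum n (λ i → g (suc i)))

    s⁻¹ : Fin n → Fin n
    s⁻¹ b = proj₁ (injective⇒surjective s-inj b)

    π : Permutation′ n
    π = permutation s s⁻¹ (λ b → proj₂ (injective⇒surjective s-inj b))
                          (λ j → s-inj (proj₂ (injective⇒surjective s-inj (s j))))

  δ : ∀ {n} → Fin n → Fin n → Carrier
  δ zero    zero    = 1#
  δ zero    (suc _) = 0#
  δ (suc _) zero    = 0#
  δ (suc a) (suc b) = δ a b

  δ-diagonal : ∀ {n} (a : Fin n) → δ a a ≡ 1#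
  δ-diagonal zero    = refl
  δ-diagonal (suc a) = δ-diagonal a

  δ-offDiagonal : ∀ {n} {a b : Fin n} → ¬ (a ≡ b) → δ a b ≡ 0#
  δ-offDiagonal {a = zero}  {zero}  a≢b = ⊥-elim (a≢b refl)
  δ-offDiagonal {a = zero}  {suc b} a≢b = refl
  δ-offDiagonal {a = suc a} {zero}  a≢b = refl
  δ-offDiagonal {a = suc a} {suc b} a≢b = δ-offDiagonal (λ a≡b → a≢b (cong suc a≡b))

  ∑-δ : ∀ n (a : Fin n) (f : Fin n → Carrier) → ∑ F n (λ j → δ a j * f j) ≡ f a
  ∑-δ (suc n) zero f = begin
    1# * f zero + ∑ F n (λ j → 0# * f (suc j))  ≡⟨ cong₂ _+_ (*-identityˡ _) (∑-cong n (λ j → zeroˡ _)) ⟩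
    f zero + ∑ F n (λ _ → 0#)                   ≡⟨ cong (f zero +_) (∑-zero n) ⟩
    f zero + 0#                                 ≡⟨ +-identityʳ _ ⟩
    f zero                                      ∎
  ∑-δ (suc n) (suc a) f =
    trans (cong₂ _+_ (zeroˡ _) (∑-δ n a (λ j → f (suc j)))) (+-identityˡ _)

  ∈-span : ∀ {r n} (w : Fin r → Vec F n) (a : Fin r) → InSpan F w (w a)
  ∈-span {r} w a = δ a , λ i → ∑-δ r a (λ j → w j i)

  lincomb-zero : ∀ {r n} {c : Fin r → Carrier} (w : Fin r → Vec F n) →
                 (∀ b → c b ≡ 0#) → ∀ i → lincomb F c w i ≡ 0#
  lincomb-zero {r} w c≡0 i =
    trans (∑-cong r (λ b → trans (cong (_* w b i) (c≡0 b)) (zeroˡ _))) (∑-zero r)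

  dot-lincombʳ : ∀ {d n} (x : Vec F n) (c : Fin d → Carrier) (w : Fin d → Vec F n) →
                 ∑ F d (λ b → c b * dot F x (w b)) ≡ dot F x (lincomb F c w)
  dot-lincombʳ {d} {n} x c w = begin
    ∑ F d (λ b → c b * ∑ F n (λ i → x i * w b i))  ≡⟨ ∑-cong d (λ b → *-distribˡ-∑ n (c b) _) ⟩
    ∑ F d (λ b → ∑ F n (λ i → c b * (x i * w b i))) ≡⟨ ∑-comm d n _ ⟩
    ∑ F n (λ i → ∑ F d (λ b → c b * (x i * w b i))) ≡⟨ ∑-cong n (λ i → ∑-cong d (λ b → x∙yz≈y∙xz _ _ _)) ⟩
    ∑ F n (λ i → ∑ F d (λ b → x i * (c b * w b i))) ≡⟨ ∑-cong n (λ i → sym (*-distribˡ-∑ d (x i) _)) ⟩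
    ∑ F n (λ i → x i * lincomb F c w i)             ∎

  ∑-lincomb-comm : ∀ {d m n} (c : Fin m → Fin d → Carrier) (γ : Fin m → Carrier)
                   (w : Fin d → Vec F n) (i : Fin n) →
                   ∑ F m (λ j → lincomb F (c j) w i * γ j)
                     ≡ lincomb F (λ b → ∑ F m (λ j → c j b * γ j)) w i
  ∑-lincomb-comm {d} {m} c γ w i = begin
    ∑ F m (λ j → ∑ F d (λ b → c j b * w b i) * γ j)   ≡⟨ ∑-cong m (λ j → *-distribʳ-∑ d (γ j) _) ⟩
    ∑ F m (λ j → ∑ F d (λ b → c j b * w b i * γ j))   ≡⟨ ∑-comm m d _ ⟩
    ∑ F d (λ b → ∑ F m (λ j → c j b * w b i * γ j))   ≡⟨ ∑-cong d (λ b → ∑-cong m (λ j → xy∙z≈xz∙y _ _ _)) ⟩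
    ∑ F d (λ b → ∑ F m (λ j → c j b * γ j * w b i))   ≡⟨ ∑-cong d (λ b → sym (*-distribʳ-∑ m (w b i) _)) ⟩
    ∑ F d (λ b → ∑ F m (λ j → c j b * γ j) * w b i)   ∎

  linIndep⇒injective : ∀ {r n} {w : Fin r → Vec F n} → LinIndep F w →
                       ∀ {a a′} → (∀ i → w a i ≡ w a′ i) → a ≡ a′
  linIndep⇒injective {r} {w = w} indep {a} {a′} wa≗wa′ with a ≟ a′
  ... | yes a≡a′ = a≡a′
  ... | no  a≢a′ = contradiction (trans (sym c-a≡1) (indep c relation a)) 1≢0
    where
    c : Fin r → Carrier
    c j = δ a j - δ a′ j

    relation : ∀ i → lincomb F c w i ≡ 0#
    relation i = begin
      ∑ F r (λ j → (δ a j - δ a′ j) * w j i)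
        ≡⟨ ∑-cong r (λ j → trans (distribʳ _ _ _) (cong (δ a j * w j i +_) (sym (-‿distribˡ-* _ _)))) ⟩
      ∑ F r (λ j → δ a j * w j i - δ a′ j * w j i)
        ≡⟨ trans (∑-distrib-+ r _ _) (cong (∑ F r (λ j → δ a j * w j i) +_) (∑-neg r _)) ⟩
      ∑ F r (λ j → δ a j * w j i) - ∑ F r (λ j → δ a′ j * w j i)
        ≡⟨ cong₂ _-_ (∑-δ r a (λ j → w j i)) (∑-δ r a′ (λ j → w j i)) ⟩
      w a i - w a′ i
        ≡⟨ cong (λ t → w a i - t) (sym (wa≗wa′ i)) ⟩
      w a i - w a i
        ≡⟨ -‿inverseʳ (w a i) ⟩
      0# ∎

    c-a≡1 : c a ≡ 1#
    c-a≡1 = begin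
      δ a a - δ a′ a  ≡⟨ cong₂ _-_ (δ-diagonal a) (δ-offDiagonal (λ a′≡a → a≢a′ (sym a′≡a))) ⟩
      1# - 0#         ≡⟨ cong (1# +_) -0#≈0# ⟩
      1# + 0#         ≡⟨ +-identityʳ 1# ⟩
      1#              ∎

    1≢0 : ¬ (1# ≡ 0#)
    1≢0 1≡0 = Field.0≢1 F (sym 1≡0)

  linIndep-subfamily⇒injective : ∀ {d r n} (w : Fin d → Vec F n) {s : Fin r → Fin d} →
                                 LinIndep F (λ j → w (s j)) → Injective _≡_ _≡_ s
  linIndep-subfamily⇒injective w indep s≡s′ = linIndep⇒injective indep (λ i → cong (λ b → w b i) s≡s′)

  -- A subfamily of all d members would be a reordering of w, carrying the relation c along.
  linIndep-subfamily-of-dependent : ∀ {d r n} (w : Fin d → Vec F n) (c : Fin d → Carrier) →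
                                    (∀ i → lincomb F c w i ≡ 0#) → ¬ (∀ b → c b ≡ 0#) →
                                    (s : Fin r → Fin d) → LinIndep F (λ j → w (s j)) → r < d
  linIndep-subfamily-of-dependent {d} w c relation c≢0 s indep
    with m≤n⇒m<n∨m≡n (injective⇒≤ (linIndep-subfamily⇒injective w indep))
  ... | inj₁ r<d  = r<d
  ... | inj₂ refl = contradiction c≡0 c≢0
    where
    s-inj : Injective _≡_ _≡_ s
    s-inj = linIndep-subfamily⇒injective w indep

    c∘s≡0 : ∀ j → c (s j) ≡ 0#
    c∘s≡0 = indep (λ j → c (s j)) (λ i → trans (∑-reindex d s-inj (λ b → c b * w b i)) (relation i))

    c≡0 : ∀ b → c b ≡ 0#
    c≡0 b with j , sj≡b ← injective⇒surjective s-inj b = trans (cong c (sym sj≡b)) (c∘s≡0 j)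

module Extension (K L : Field) (ι : FieldHom K L) where
  open FieldHom ι
  open LinearAlgebra L
  open CommutativeRing (commutativeRing L) using (_+_; _*_; 0#)
  open RingProperties (CommutativeRing.ring (commutativeRing L)) using (x+x≈x⇒x≈0)

  embed : ∀ {n} → Vec K n → Vec L n
  embed x i = ⟦ x i ⟧

  hom-0 : ⟦ Field.0# K ⟧ ≡ 0#
  hom-0 = x+x≈x⇒x≈0 _ (trans (sym (hom-+ _ _)) (cong ⟦_⟧ (Field.+-identityˡ K _)))

  hom-∑ : ∀ n (f : Fin n → Field.Carrier K) → ⟦ ∑ K n f ⟧ ≡ ∑ L n (λ i → ⟦ f i ⟧)
  hom-∑ zero    f = hom-0
  hom-∑ (suc n) f = trans (hom-+ _ _) (cong (⟦ f zero ⟧ +_) (hom-∑ n (λ i → f (suc i))))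

  hom-lincomb : ∀ {r n} (c : Fin r → Field.Carrier K) (w : Fin r → Vec K n) (i : Fin n) →
                ⟦ lincomb K c w i ⟧ ≡ lincomb L (embed c) (λ b → embed (w b)) i
  hom-lincomb {r} c w i = trans (hom-∑ r _) (∑-cong r (λ b → hom-* (c b) (w b i)))

  coordinates-in-span : ∀ {m n d} (γ : Fin m → Field.Carrier L) (v : Vec L n)
                        (Γ : Fin n → Fin m → Field.Carrier K) (A : Fin d → Vec K n) →
                        RankMetric.IsCoordMatrix K L ι γ v Γ → (∀ j → InSpan K A (col K Γ j)) →
                        InSpan L (λ b → embed (A b)) v
  coordinates-in-span {m} γ v Γ A coord Γ-in-span =
    (λ b → ∑ L m (λ j → ⟦ c j b ⟧ * γ j)) , λ i → begin
      lincomb L (λ b → ∑ L m (λ j → ⟦ c j b ⟧ * γ j)) (λ b → embed (A b)) i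
        ≡⟨ sym (∑-lincomb-comm (λ j → embed (c j)) γ (λ b → embed (A b)) i) ⟩
      ∑ L m (λ j → lincomb L (embed (c j)) (λ b → embed (A b)) i * γ j)
        ≡⟨ ∑-cong m (λ j → cong (_* γ j) (sym (hom-lincomb (c j) A i))) ⟩
      ∑ L m (λ j → ⟦ lincomb K (c j) A i ⟧ * γ j)
        ≡⟨ ∑-cong m (λ j → cong (λ t → ⟦ t ⟧ * γ j) (proj₂ (Γ-in-span j) i)) ⟩
      ∑ L m (λ j → ⟦ Γ i j ⟧ * γ j)
        ≡⟨ sym (coord i) ⟩
      v i ∎
    where
    open ≡-Reasoning
    c : Fin m → Fin _ → Field.Carrier K
    c j = proj₁ (Γ-in-span j)

lemma4p8 : (q m n k : ℕ) → 0 < m → 0 < n → 0 < k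
    → (K L : Field) (ι : FieldHom K L)
    → HasCard K q
    → (γ : Fin m → Field.Carrier L) → RankMetric.IsBasisOver K L ι m γ
    → (G : Fin k → Vec L n) → LinIndep L G
    → (v : Vec L n) → RankMetric.InDual K L ι G v
    → ¬ (∀ i → v i ≡ Field.0# L)
    → (Γ : Fin n → Fin m → Field.Carrier K) → RankMetric.IsCoordMatrix K L ι γ v Γ
    → (d : ℕ) (A : Fin d → Vec K n) → IsBasisOfSpan K A (col K Γ)
    → RankMetric.Dependent K L ι G A
lemma4p8 _ _ n _ _ _ _ K L ι _ γ _ G _ v v∈C⊥ v≢0 Γ coord d A (_ , _ , Γ-in-span) r ((s , indep) , _) =
  linIndep-subfamily-of-dependent (col L (GAt G A)) c relation c≢0 s indep
  where
  open RankMetric K L ι using (GAt)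
  open LinearAlgebra L
  open Extension K L ι

  v∈span : InSpan L (λ b → embed (A b)) v
  v∈span = coordinates-in-span γ v Γ A coord Γ-in-span

  c : Fin d → Field.Carrier L
  c = proj₁ v∈span

  relation : ∀ a → lincomb L c (col L (GAt G A)) a ≡ Field.0# L
  relation a = begin
    ∑ L d (λ b → c b * dot L (G a) (embed (A b)))  ≡⟨ dot-lincombʳ (G a) c (λ b → embed (A b)) ⟩
    dot L (G a) (lincomb L c (λ b → embed (A b)))  ≡⟨ ∑-cong n (λ i → cong (G a i *_) (proj₂ v∈span i)) ⟩
    dot L (G a) v                                  ≡⟨ v∈C⊥ (G a) (∈-span G a) ⟩
    Field.0# L                                     ∎
    where open ≡-Reasoning ; open Field L using (_*_)

  c≢0 : ¬ (∀ b → c b ≡ Field.0# L)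
  c≢0 c≡0 = v≢0 (λ i → trans (sym (proj₂ v∈span i)) (lincomb-zero (λ b → embed (A b)) c≡0 i))
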